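{- For every agent $i$, the schema $\neg U_i\phi\to U_i\neg U_i\phi$ is not valid: there is a formula $\phi$ of $\mathbf{LUT}$ such that $\nvDash\neg U_i\phi\to U_i\neg U_i\phi$.
   Context: Let $\mathbf{P}$ be a countably infinite set of propositional variables and $\mathbf{I}$ a finite set of agents. The language $\mathbf{LUT}$ is given by $\phi::= p\mid\neg\phi\mid(\phi\land\phi)\mid K_i\phi\mid[\phi]\phi\mid U_i\phi$ ($p\in\mathbf{P}$, $i\in\mathbf{I}$), with $\top$ and other connectives defined as usual; $\mathbf{EL}$ is the fragment without $[\cdot]$ and $U_i$. A model is $\mathcal{M}=\langle S,\{R_i\}_{i\in\mathbf{I}},V\rangle$ with $S\neq\emptyset$, each $R_i$ a reflexive relation on $S$, $V:\mathbf{P}\to2^S$. Truth: $p$ true at $s$ iff $s\in V(p)$; Boolean clauses as usual; $\mathcal{M},s\vDash K_i\phi$ iff $\phi$ holds at all $t$ with $sR_it$; $\mathcal{M},s\vDash[\psi]\phi$ iff ($\mathcal{M},s\vDash\psi$ implies $\mathcal{M}|_\psi,s\vDash\phi$), with $\mathcal{M}|_\psi$ the restriction of $\mathcal{M}$ to the states where $\psi$ is true; $\mathcal{M},s\vDash U_i\phi$ iff $\mathcal{M},s\vDash\phi$ and for all $\psi\in\mathbf{EL}$, $\mathcal{M},s\vDash[\psi]\neg K_i\phi$. $\vDash\phi$ means $\phi$ is true at every state of every model. -}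

module Defs where

open import Data.Nat using (ℕ)
open import Data.Fin using (Fin)
open import Data.Product using (Σ; _×_; _,_; proj₁)
open import Data.Empty using (⊥)
open import Relation.Nullary using (¬_)

data Form (n : ℕ) : Set where
  var  : ℕ → Form n
  ¬'_  : Form n → Form n
  _∧'_ : Form n → Form n → Form n
  K    : Fin n → Form n → Form n
  Ann  : Form n → Form n → Form n  -- [ψ]φ written Ann ψ φ
  U    : Fin n → Form n → Form n

_→'_ : ∀ {n} → Form n → Form n → Form n
φ →' ψ = ¬' (φ ∧' (¬' ψ))

data ELForm (n : ℕ) : Set where
  var  : ℕ → ELForm n
  ¬'_  : ELForm n → ELForm n
  _∧'_ : ELForm n → ELForm n → ELForm n
  K    : Fin n → ELForm n → ELForm n

record Model (n : ℕ) : Set₁ where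
  field
    S     : Set
    inhab : S
    R     : Fin n → S → S → Set
    refl  : ∀ i s → R i s s
    V     : ℕ → S → Set
open Model public

restrict : ∀ {n} (M : Model n) (P : S M → Set) → Σ (S M) P → Model n
restrict M P s₀ = record
  { S     = Σ (S M) P
  ; inhab = s₀
  ; R     = λ i s t → R M i (proj₁ s) (proj₁ t)
  ; refl  = λ i s → refl M i (proj₁ s)
  ; V     = λ p s → V M p (proj₁ s)
  }

SatEL : ∀ {n} (M : Model n) → S M → ELForm n → Set
SatEL M s (var p)  = V M p s
SatEL M s (¬' φ)   = ¬ SatEL M s φ
SatEL M s (φ ∧' ψ) = SatEL M s φ × SatEL M s ψ
SatEL M s (K i φ)  = ∀ t → R M i s t → SatEL M t φ

-- satisfaction for LUT formulas
-- The U clause unfolds  M,s ⊨ φ  and  ∀ψ∈EL. M,s ⊨ [ψ]¬K_i φ ,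
-- i.e.  ∀ψ∈EL. M,s ⊨ ψ → ¬ (∀ t. sR_it in M|ψ → M|ψ,t ⊨ φ).
Sat : ∀ {n} (M : Model n) → S M → Form n → Set
Sat M s (var p)   = V M p s
Sat M s (¬' φ)    = ¬ Sat M s φ
Sat M s (φ ∧' ψ)  = Sat M s φ × Sat M s ψ
Sat M s (K i φ)   = ∀ t → R M i s t → Sat M t φ
Sat M s (Ann ψ φ) = (h : Sat M s ψ) →
  Sat (restrict M (λ t → Sat M t ψ) (s , h)) (s , h) φ
Sat M s (U i φ)   = Sat M s φ ×
  (∀ (ψ : ELForm _) (h : SatEL M s ψ) →
     let M' = restrict M (λ t → SatEL M t ψ) (s , h) in
     ¬ (∀ t → R M' i (s , h) t → Sat M' t φ))

Valid : ∀ {n} → Form n → Set₁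
Valid φ = ∀ (M : Model _) (s : S M) → Sat M s φ

{-# OPTIONS --safe #-}
module Submission where

-- Take φ = p in a model where p is false everywhere. Then ¬U_i p holds, since U_i is
-- factive; but ¬U_i p is not unknowable: announcing ¬p leaves a model in which p is
-- still false everywhere, so there ¬U_i p holds everywhere and agent i knows it.

open import Defs
open import Data.Nat using (ℕ)
open import Data.Fin using (Fin)
open import Data.Product using (Σ; _,_; proj₁)
open import Data.Unit using (⊤; tt)
open import Data.Empty using (⊥)
open import Relation.Nullary using (¬_)

module _ {n : ℕ} where

  countermodel⇒¬Valid-→' : (φ ψ : Form n) (M : Model n) (s : S M) →
                           Sat M s φ → ¬ Sat M s ψ → ¬ Valid (φ →' ψ)
  countermodel⇒¬Valid-→' φ ψ M s φ-holds ψ-fails valid =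
    valid M s (φ-holds , ψ-fails)

  U-factive : (M : Model n) (s : S M) (i : Fin n) (φ : Form n) →
              Sat M s (U i φ) → Sat M s φ
  U-factive M s i φ = proj₁

  ¬U-of-false : (M : Model n) (s : S M) (i : Fin n) (φ : Form n) →
                ¬ Sat M s φ → Sat M s (¬' U i φ)
  ¬U-of-false M s i φ φ-fails u = φ-fails (U-factive M s i φ u)

  ¬U¬U-of-var-false-everywhere : (M : Model n) (s : S M) (i : Fin n) (p : ℕ) →
                                 (∀ t → ¬ V M p t) →
                                 ¬ Sat M s (U i (¬' U i (var p)))
  ¬U¬U-of-var-false-everywhere M s i p p-false (_ , unknowable) =
    unknowable (¬' var p) (p-false s)
      (λ t _ → ¬U-of-false _ t i (var p) (p-false (proj₁ t)))

  emptyValuationModel : Model n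
  emptyValuationModel = record
    { S = ⊤ ; inhab = tt ; R = λ _ _ _ → ⊤ ; refl = λ _ _ → tt ; V = λ _ _ → ⊥ }

mainTheorem7 : (n : ℕ) (i : Fin n) →
    Σ (Form n) (λ φ → ¬ Valid ((¬' (U i φ)) →' U i (¬' (U i φ))))
mainTheorem7 n i = var 0 ,
  countermodel⇒¬Valid-→' (¬' U i (var 0)) (U i (¬' U i (var 0))) M tt
    (¬U-of-false M tt i (var 0) p-false)
    (¬U¬U-of-var-false-everywhere M tt i 0 (λ _ → p-false))
  where
    M : Model n
    M = emptyValuationModel

    p-false : ¬ V M 0 tt
    p-false ()
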